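{- Let $n\ge 1$ and let $\pi$ be a general lattice path from $(0,0)$ to $(n,n)$. Then $\pi$ is a Delannoy path if and only if all its interior vertical lines $x=k$, $1\le k\le n-1$, are active for $\pi$.
   Context: A general lattice path is a finite sequence of steps, each step lying in $\mathbb{N}\times\mathbb{N}\setminus\{(0,0)\}$. A path starting at $(0,0)$ has as vertices $(0,0)$ and the successive partial sums of its steps; consecutive vertices are joined by line segments. A Delannoy path is a path all of whose steps are among $(1,0),(0,1),(1,1)$. A subpath of a path $\pi$ is a subsequence of consecutive steps of $\pi$; it is nonempty if it has at least one step. A path is balanced if its terminal vertex lies on the line of slope $1$ through its initial vertex. A path is subdiagonal if it never rises above the line of slope $1$ through its initial vertex, and superdiagonal if it never falls below the line of slope $1$ through its initial vertex. For $1\le k\le n-1$, the vertical line $x=k$ is active for $\pi$ if it contains a vertex $V$ of $\pi$ such that (i) $V$ lies on the line $y=x$, or (ii) $V$ lies strictly below $y=x$ and $V$ is the initial vertex of a nonempty balanced subdiagonal subpath of $\pi$, or (iii) $V$ lies strictly above $y=x$ and $V$ is the terminal vertex of a nonempty balanced superdiagonal subpath of $\pi$. -}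

module Defs where

open import Data.Nat using (ℕ; zero; suc; _+_; _≤_; _<_; _∸_)
open import Data.Product using (_×_; _,_; proj₁; proj₂; ∃-syntax)
open import Data.Sum using (_⊎_)
open import Data.List using (List; []; _∷_; take; length)
open import Data.List.Relation.Unary.All using (All)
open import Relation.Binary.PropositionalEquality using (_≡_; _≢_)

Step : Set
Step = ℕ × ℕ

IsStep : Step → Set
IsStep s = s ≢ (0 , 0)

GeneralPath : List Step → Set
GeneralPath π = All IsStep π

sumSteps : List Step → ℕ × ℕ
sumSteps [] = (0 , 0)
sumSteps ((a , b) ∷ π) = (a + proj₁ (sumSteps π) , b + proj₂ (sumSteps π))

-- The m-th vertex (0 ≤ m ≤ length π) of the path starting at (0,0):
-- the sum of its first m steps.  Vertex 0 is (0,0).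
vertex : List Step → ℕ → ℕ × ℕ
vertex π m = sumSteps (take m π)

vx vy : List Step → ℕ → ℕ
vx π m = proj₁ (vertex π m)
vy π m = proj₂ (vertex π m)

endpoint : List Step → ℕ × ℕ
endpoint π = sumSteps π

data DelannoyStep : Step → Set where
  east  : DelannoyStep (1 , 0)
  north : DelannoyStep (0 , 1)
  diag  : DelannoyStep (1 , 1)

IsDelannoy : List Step → Set
IsDelannoy π = All DelannoyStep π

-- The subpath consisting of steps i+1, ..., j (0 ≤ i ≤ j ≤ length π) has
-- initial vertex V_i and terminal vertex V_j; it is nonempty iff i < j.
NonemptySubpath : List Step → ℕ → ℕ → Set
NonemptySubpath π i j = i < j × j ≤ length π

-- Balanced: terminal vertex on the slope-1 line through the initial vertex,
-- i.e. x_j - x_i = y_j - y_i  (written without subtraction).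
Balanced : List Step → ℕ → ℕ → Set
Balanced π i j = vx π j + vy π i ≡ vy π j + vx π i

-- Subdiagonal: every vertex V_m (i ≤ m ≤ j) satisfies y_m - y_i ≤ x_m - x_i.
-- (Checking vertices suffices since segments are straight.)
Subdiagonal : List Step → ℕ → ℕ → Set
Subdiagonal π i j = ∀ m → i ≤ m → m ≤ j → vy π m + vx π i ≤ vx π m + vy π i

Superdiagonal : List Step → ℕ → ℕ → Set
Superdiagonal π i j = ∀ m → i ≤ m → m ≤ j → vx π m + vy π i ≤ vy π m + vx π i

Active : List Step → ℕ → Set
Active π k =
  ∃[ m ] (m ≤ length π × vx π m ≡ k ×
    ( vy π m ≡ vx π m
    ⊎ (vy π m < vx π m ×
        ∃[ j ] (NonemptySubpath π m j × Balanced π m j × Subdiagonal π m j))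
    ⊎ (vx π m < vy π m ×
        ∃[ i ] (NonemptySubpath π i m × Balanced π i m × Superdiagonal π i m))))

-- Measure vertices by their height n + y - x: the diagonal is height n, a balanced subpath has
-- equal end heights, and a vertical step strictly raises the height.
-- On a Delannoy path x and the height change by at most one per step, and the vertices on a line
-- x = k form a vertical run.  If the run ends below the diagonal, the path leaves it by a
-- non-rising step and has to climb back to that height before reaching (n, n): a subdiagonal
-- excursion.  If it starts above the diagonal, symmetrically; otherwise the run meets the diagonal.
-- Conversely, an x-step of two or more skips a line.  Once x-steps are at most one, the height
-- drops by at most one per step, so a y-step of two or more jumps over a level L that the path
-- last held before it (below the diagonal) or first regains after it (above).  That vertex is
-- left, resp. entered, by a non-vertical step, so it is the only candidate on its line, and the
-- jump keeps its excursion from closing at height L.  A vertical step straddling the diagonal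
-- leaves its own line without candidates.

module Submission where

open import Data.Nat
open import Data.Nat.Properties
open import Algebra.Properties.CommutativeSemigroup +-commutativeSemigroup
  using (xy∙z≈xz∙y; xy∙z≈x∙zy; xy∙z≈zx∙y; xy∙z≈y∙xz; x∙yz≈yx∙z)
open import Data.Empty using (⊥; ⊥-elim)
open import Data.List using (List; []; _∷_; length)
open import Data.List.Properties using (take-all)
open import Data.List.Relation.Unary.All using (All; []; _∷_)
open import Data.Product using (_×_; _,_; proj₁; proj₂; ∃; ∃-syntax; ∃₂)
open import Data.Sum using (inj₁; inj₂)
open import Function.Bundles using (_⇔_; mk⇔; Equivalence)
open import Relation.Binary.PropositionalEquality
open import Relation.Nullary using (¬_; yes; no)

open import Defs

open Equivalence using (to; from)

with-left-end : ∀ {P : ℕ → Set} {a m} → P a → (∀ k → a < k → k < m → P k) →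
                ∀ k → a ≤ k → k < m → P k
with-left-end Pa inside k a≤k k<m with m≤n⇒m<n∨m≡n a≤k
... | inj₁ a<k = inside k a<k k<m
... | inj₂ refl = Pa

with-right-end : ∀ {P : ℕ → Set} {m b} → P (suc b) → (∀ k → m < k → k ≤ b → P k) →
                 ∀ k → m < k → k ≤ suc b → P k
with-right-end Pb inside k m<k k≤1+b with m≤n⇒m<n∨m≡n k≤1+b
... | inj₁ k<1+b = inside k m<k (≤-pred k<1+b)
... | inj₂ refl = Pb

with-ends : ∀ {P : ℕ → Set} {a b} → P a → P b → (∀ k → a < k → k < b → P k) →
            ∀ k → a ≤ k → k ≤ b → P k
with-ends Pa Pb inside k a≤k k≤b with m≤n⇒m<n∨m≡n k≤b
... | inj₁ k<b = with-left-end Pa inside k a≤k k<b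
... | inj₂ refl = Pb

Rising Falling : (ℕ → ℕ) → ℕ → ℕ → Set
Rising  g a b = ∀ k → a ≤ k → k < b → g (suc k) ≤ suc (g k)
Falling g a b = ∀ k → a ≤ k → k < b → g k ≤ suc (g (suc k))

module _ (g : ℕ → ℕ) {L : ℕ} where

  first-hit-rising : ∀ {a b} → a ≤‴ b → g a ≤ L → L ≤ g b → Rising g a b →
    ∃[ m ] (a ≤ m × m ≤ b × g m ≡ L × (∀ k → a ≤ k → k < m → g k < L))
  first-hit-rising {a} a≤b ga≤L L≤gb rising with L ≤? g a
  ... | yes L≤ga = a , ≤-refl , ≤‴⇒≤ a≤b , ≤-antisym ga≤L L≤ga , λ k a≤k k<a → ⊥-elim (<⇒≱ k<a a≤k)
  first-hit-rising ≤‴-refl ga≤L L≤gb rising | no L≰ga = ⊥-elim (L≰ga L≤gb)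
  first-hit-rising {a} (≤‴-step a<b) ga≤L L≤gb rising | no L≰ga
    with first-hit-rising a<b (≤-trans (rising a ≤-refl (≤‴⇒≤ a<b)) (≰⇒> L≰ga)) L≤gb
                         (λ k a<k → rising k (<⇒≤ a<k))
  ... | m , a<m , m≤b , gm≡L , below = m , <⇒≤ a<m , m≤b , gm≡L , with-left-end (≰⇒> L≰ga) below

  first-hit-falling : ∀ {a b} → a ≤‴ b → L ≤ g a → g b ≤ L → Falling g a b →
    ∃[ m ] (a ≤ m × m ≤ b × g m ≡ L × (∀ k → a ≤ k → k < m → L < g k))
  first-hit-falling {a} a≤b L≤ga gb≤L falling with g a ≤? L
  ... | yes ga≤L = a , ≤-refl , ≤‴⇒≤ a≤b , ≤-antisym ga≤L L≤ga , λ k a≤k k<a → ⊥-elim (<⇒≱ k<a a≤k)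
  first-hit-falling ≤‴-refl L≤ga gb≤L falling | no ga≰L = ⊥-elim (ga≰L gb≤L)
  first-hit-falling {a} (≤‴-step a<b) L≤ga gb≤L falling | no ga≰L
    with first-hit-falling a<b (≤-pred (≤-trans (≰⇒> ga≰L) (falling a ≤-refl (≤‴⇒≤ a<b)))) gb≤L
                          (λ k a<k → falling k (<⇒≤ a<k))
  ... | m , a<m , m≤b , gm≡L , above = m , <⇒≤ a<m , m≤b , gm≡L , with-left-end (≰⇒> ga≰L) above

  last-hit-rising : ∀ {a b} → a ≤′ b → g a ≤ L → L ≤ g b → Rising g a b →
    ∃[ m ] (a ≤ m × m ≤ b × g m ≡ L × (∀ k → m < k → k ≤ b → L < g k))
  last-hit-rising {b = b} a≤b ga≤L L≤gb rising with g b ≤? L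
  ... | yes gb≤L = b , ≤′⇒≤ a≤b , ≤-refl , ≤-antisym gb≤L L≤gb , λ k b<k k≤b → ⊥-elim (<⇒≱ b<k k≤b)
  last-hit-rising ≤′-refl ga≤L L≤gb rising | no gb≰L = ⊥-elim (gb≰L ga≤L)
  last-hit-rising {b = suc b} (≤′-step a≤b) ga≤L L≤gb rising | no gb≰L
    with last-hit-rising a≤b ga≤L (≤-pred (≤-trans (≰⇒> gb≰L) (rising b (≤′⇒≤ a≤b) ≤-refl)))
                        (λ k a≤k k<b → rising k a≤k (m≤n⇒m≤1+n k<b))
  ... | m , a≤m , m≤b , gm≡L , above = m , a≤m , m≤n⇒m≤1+n m≤b , gm≡L , with-right-end (≰⇒> gb≰L) above

  last-hit-falling : ∀ {a b} → a ≤′ b → L ≤ g a → g b ≤ L → Falling g a b →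
    ∃[ m ] (a ≤ m × m ≤ b × g m ≡ L × (∀ k → m < k → k ≤ b → g k < L))
  last-hit-falling {b = b} a≤b L≤ga gb≤L falling with L ≤? g b
  ... | yes L≤gb = b , ≤′⇒≤ a≤b , ≤-refl , ≤-antisym gb≤L L≤gb , λ k b<k k≤b → ⊥-elim (<⇒≱ b<k k≤b)
  last-hit-falling ≤′-refl L≤ga gb≤L falling | no L≰gb = ⊥-elim (L≰gb L≤ga)
  last-hit-falling {b = suc b} (≤′-step a≤b) L≤ga gb≤L falling | no L≰gb
    with last-hit-falling a≤b L≤ga (≤-trans (falling b (≤′⇒≤ a≤b) ≤-refl) (≰⇒> L≰gb))
                         (λ k a≤k k<b → falling k a≤k (m≤n⇒m≤1+n k<b))
  ... | m , a≤m , m≤b , gm≡L , below = m , a≤m , m≤n⇒m≤1+n m≤b , gm≡L , with-right-end (≰⇒> L≰gb) below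

module _ {c g x y g′ x′ y′ : ℕ} (e : g + x ≡ y + c) (e′ : g′ + x′ ≡ y′ + c) where
  open ≡-Reasoning

  private
    shiftˡ : g + (x + x′) ≡ x′ + y + c
    shiftˡ = begin
      g + (x + x′) ≡⟨ +-assoc g x x′ ⟨
      g + x + x′   ≡⟨ cong (_+ x′) e ⟩
      y + c + x′   ≡⟨ xy∙z≈zx∙y y c x′ ⟩
      x′ + y + c   ∎

    shiftʳ : g′ + (x + x′) ≡ y′ + x + c
    shiftʳ = begin
      g′ + (x + x′) ≡⟨ cong (g′ +_) (+-comm x x′) ⟩
      g′ + (x′ + x) ≡⟨ +-assoc g′ x′ x ⟨
      g′ + x′ + x   ≡⟨ cong (_+ x) e′ ⟩
      y′ + c + x    ≡⟨ xy∙z≈xz∙y y′ c x ⟩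
      y′ + x + c    ∎

  offset-≤⇔ : g ≤ g′ ⇔ x′ + y ≤ y′ + x
  offset-≤⇔ = mk⇔
    (λ g≤g′ → +-cancelʳ-≤ c _ _ (subst₂ _≤_ shiftˡ shiftʳ (+-monoˡ-≤ (x + x′) g≤g′)))
    (λ le → +-cancelʳ-≤ (x + x′) _ _ (subst₂ _≤_ (sym shiftˡ) (sym shiftʳ) (+-monoˡ-≤ c le)))

  offset-≡⇔ : g ≡ g′ ⇔ x′ + y ≡ y′ + x
  offset-≡⇔ = mk⇔
    (λ g≡g′ → +-cancelʳ-≡ c _ _ (trans (sym shiftˡ) (trans (cong (_+ (x + x′)) g≡g′) shiftʳ)))
    (λ eq → +-cancelʳ-≡ (x + x′) _ _ (trans shiftˡ (trans (cong (_+ c) eq) (sym shiftʳ))))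

module _ {p a q b d : ℕ} (e : p + a ≡ q + b) where
  open ≤-Reasoning

  sum≡⇒≤ : a ≤ d + b → q ≤ d + p
  sum≡⇒≤ a≤d+b = +-cancelʳ-≤ b q (d + p) (begin
    q + b       ≡⟨ e ⟨
    p + a       ≤⟨ +-monoʳ-≤ p a≤d+b ⟩
    p + (d + b) ≡⟨ x∙yz≈yx∙z p d b ⟩
    d + p + b   ∎)

  sum≡⇒≥ : d + a ≤ b → d + q ≤ p
  sum≡⇒≥ d+a≤b = +-cancelʳ-≤ a (d + q) p (begin
    d + q + a   ≡⟨ xy∙z≈y∙xz d q a ⟩
    q + (d + a) ≤⟨ +-monoʳ-≤ q d+a≤b ⟩
    q + b       ≡⟨ e ⟨
    p + a       ∎)

pointwise⇔ : ∀ {A B : ℕ → Set} {i j} → (∀ q → A q ⇔ B q) →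
             (∀ q → i ≤ q → q ≤ j → A q) ⇔ (∀ q → i ≤ q → q ≤ j → B q)
pointwise⇔ A⇔B = mk⇔ (λ f q i≤q q≤j → to (A⇔B q) (f q i≤q q≤j))
                     (λ f q i≤q q≤j → from (A⇔B q) (f q i≤q q≤j))

monotone-suc : ∀ {g : ℕ → ℕ} → (∀ m → g m ≤ g (suc m)) → ∀ {i j} → i ≤ j → g i ≤ g j
monotone-suc {g} step i≤j = go (≤⇒≤′ i≤j)
  where
  go : ∀ {i j} → i ≤′ j → g i ≤ g j
  go ≤′-refl = ≤-refl
  go (≤′-step i≤j) = ≤-trans (go i≤j) (step _)

-- (0 , 0) past the end of the path, so that vx-suc and vy-suc hold for every m.
stepAt : List Step → ℕ → Step
stepAt []      _       = (0 , 0)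
stepAt (s ∷ π) zero    = s
stepAt (s ∷ π) (suc m) = stepAt π m

vx-suc : ∀ π m → vx π (suc m) ≡ vx π m + proj₁ (stepAt π m)
vx-suc []            zero    = refl
vx-suc []            (suc m) = refl
vx-suc ((a , b) ∷ π) zero    = +-identityʳ a
vx-suc ((a , b) ∷ π) (suc m) = trans (cong (a +_) (vx-suc π m)) (sym (+-assoc a _ _))

vy-suc : ∀ π m → vy π (suc m) ≡ vy π m + proj₂ (stepAt π m)
vy-suc []            zero    = refl
vy-suc []            (suc m) = refl
vy-suc ((a , b) ∷ π) zero    = +-identityʳ b
vy-suc ((a , b) ∷ π) (suc m) = trans (cong (b +_) (vy-suc π m)) (sym (+-assoc b _ _))

vertex-beyond : ∀ π {m} → length π ≤ m → vertex π m ≡ endpoint π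
vertex-beyond π {m} N≤m = cong sumSteps (take-all m π N≤m)

All-stepAt : ∀ {P : Step → Set} {π m} → All P π → m < length π → P (stepAt π m)
All-stepAt {m = zero}  (p ∷ _)  _         = p
All-stepAt {m = suc m} (_ ∷ ps) (s≤s m<N) = All-stepAt ps m<N

stepAt-All : ∀ {P : Step → Set} π → (∀ {m} → m < length π → P (stepAt π m)) → All P π
stepAt-All []      _ = []
stepAt-All (s ∷ π) f = f (s≤s z≤n) ∷ stepAt-All π (λ m<N → f (s≤s m<N))

delannoy-bounded : ∀ {s} → DelannoyStep s → proj₁ s ≤ 1 × proj₂ s ≤ 1
delannoy-bounded east  = s≤s z≤n , z≤n
delannoy-bounded north = z≤n , s≤s z≤n
delannoy-bounded diag  = s≤s z≤n , s≤s z≤n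

bounded-delannoy : ∀ {s} → IsStep s → proj₁ s ≤ 1 → proj₂ s ≤ 1 → DelannoyStep s
bounded-delannoy {0 , 0} s≢0 _ _ = ⊥-elim (s≢0 refl)
bounded-delannoy {0 , 1} _ _ _ = north
bounded-delannoy {1 , 0} _ _ _ = east
bounded-delannoy {1 , 1} _ _ _ = diag
bounded-delannoy {suc (suc _) , _} _ (s≤s ()) _
bounded-delannoy {_ , suc (suc _)} _ _ (s≤s ())

isStep-vertical : ∀ {s} → IsStep s → proj₁ s ≡ 0 → 0 < proj₂ s
isStep-vertical {_ , zero}  s≢0 refl = ⊥-elim (s≢0 refl)
isStep-vertical {_ , suc _} _   _    = s≤s z≤n

module Heights (π : List Step) (n : ℕ) (end : endpoint π ≡ (n , n)) where

  N : ℕ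
  N = length π

  X Y δx δy : ℕ → ℕ
  X = vx π
  Y = vy π
  δx m = proj₁ (stepAt π m)
  δy m = proj₂ (stepAt π m)

  X-mono : ∀ {i j} → i ≤ j → X i ≤ X j
  X-mono = monotone-suc λ m → subst (X m ≤_) (sym (vx-suc π m)) (m≤m+n _ _)

  Y-mono : ∀ {i j} → i ≤ j → Y i ≤ Y j
  Y-mono = monotone-suc λ m → subst (Y m ≤_) (sym (vy-suc π m)) (m≤m+n _ _)

  X-end : ∀ {m} → N ≤ m → X m ≡ n
  X-end N≤m = cong proj₁ (trans (vertex-beyond π N≤m) end)

  Y-end : ∀ {m} → N ≤ m → Y m ≡ n
  Y-end N≤m = cong proj₂ (trans (vertex-beyond π N≤m) end)

  X≤n : ∀ m → X m ≤ n
  X≤n m = subst (X m ≤_) (X-end (m≤n+m N m)) (X-mono (m≤m+n m N))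

  Y≤n : ∀ m → Y m ≤ n
  Y≤n m = subst (Y m ≤_) (Y-end (m≤n+m N m)) (Y-mono (m≤m+n m N))

  vertical⇒δx≡0 : ∀ {m} → X (suc m) ≡ X m → δx m ≡ 0
  vertical⇒δx≡0 {m} vertical =
    +-cancelˡ-≡ (X m) _ _ (trans (sym (vx-suc π m)) (trans vertical (sym (+-identityʳ (X m)))))

  δx≡0⇒vertical : ∀ {m} → δx m ≡ 0 → X (suc m) ≡ X m
  δx≡0⇒vertical {m} δx≡0 = trans (vx-suc π m) (trans (cong (X m +_) δx≡0) (+-identityʳ (X m)))

  ¬X-strictly-between : ∀ t v → X t < X v → X v < X (suc t) → ⊥
  ¬X-strictly-between t v Xt<Xv Xv<X[1+t] with v ≤? t
  ... | yes v≤t = <⇒≱ Xt<Xv (X-mono v≤t)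
  ... | no  v≰t = <⇒≱ Xv<X[1+t] (X-mono (≰⇒> v≰t))

  before-line-end : ∀ {m w} → X m < X (suc m) → X w ≡ X m → w ≤ m
  before-line-end Xm<X[1+m] Xw≡Xm =
    ≮⇒≥ λ m<w → <⇒≱ Xm<X[1+m] (≤-trans (X-mono m<w) (≤-reflexive Xw≡Xm))

  after-line-start : ∀ {m w} → X m < X (suc m) → X w ≡ X (suc m) → suc m ≤ w
  after-line-start Xm<X[1+m] Xw≡X[1+m] =
    ≮⇒≥ λ w<1+m → <⇒≱ Xm<X[1+m] (≤-trans (≤-reflexive (sym Xw≡X[1+m])) (X-mono (≤-pred w<1+m)))

  -- n + (y_m - x_m); the subtraction never truncates since x_m ≤ n (X≤n).
  height : ℕ → ℕ
  height m = Y m + n ∸ X m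

  height+X : ∀ m → height m + X m ≡ Y m + n
  height+X m = m∸n+n≡m (≤-trans (X≤n m) (m≤n+m n (Y m)))

  height-≤⇔ : ∀ i j → height i ≤ height j ⇔ X j + Y i ≤ Y j + X i
  height-≤⇔ i j = offset-≤⇔ (height+X i) (height+X j)

  height-≡⇔ : ∀ i j → height i ≡ height j ⇔ X j + Y i ≡ Y j + X i
  height-≡⇔ i j = offset-≡⇔ (height+X i) (height+X j)

  height-<⇔ : ∀ i j → height i < height j ⇔ X j + Y i < Y j + X i
  height-<⇔ i j = subst (λ z → height i < height j ⇔ z ≤ Y j + X i) (+-suc (X j) (Y i))
                        (offset-≤⇔ (cong suc (height+X i)) (height+X j))

  below⇔ : ∀ v → height v < n ⇔ Y v < X v
  below⇔ v = height-<⇔ v 0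

  above⇔ : ∀ v → n < height v ⇔ X v < Y v
  above⇔ v = subst₂ (λ a b → n < height v ⇔ a < b) (+-identityʳ (X v)) (+-identityʳ (Y v))
                    (height-<⇔ 0 v)

  height-end : height N ≡ n
  height-end = from (height-≡⇔ N 0) (trans (Y-end ≤-refl) (sym (X-end ≤-refl)))

  height-along-line : ∀ {i j} → i ≤ j → X i ≡ X j → height i ≤ height j
  height-along-line {i} {j} i≤j Xi≡Xj = from (height-≤⇔ i j) (begin
    X j + Y i ≡⟨ cong (_+ Y i) Xi≡Xj ⟨
    X i + Y i ≡⟨ +-comm (X i) (Y i) ⟩
    Y i + X i ≤⟨ +-monoˡ-≤ (X i) (Y-mono i≤j) ⟩
    Y j + X i ∎)
    where open ≤-Reasoning

  below⇒1≤X : ∀ v → height v < n → 1 ≤ X v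
  below⇒1≤X v hv<n = ≤-<-trans z≤n (to (below⇔ v) hv<n)

  above⇒X<n : ∀ v → n < height v → X v < n
  above⇒X<n v n<hv = <-≤-trans (to (above⇔ v) n<hv) (Y≤n v)

  height-step : ∀ m → height (suc m) + δx m ≡ height m + δy m
  height-step m = +-cancelʳ-≡ (X m) _ _ (begin
    height (suc m) + δx m + X m   ≡⟨ xy∙z≈x∙zy (height (suc m)) (δx m) (X m) ⟩
    height (suc m) + (X m + δx m) ≡⟨ cong (height (suc m) +_) (vx-suc π m) ⟨
    height (suc m) + X (suc m)    ≡⟨ height+X (suc m) ⟩
    Y (suc m) + n                 ≡⟨ cong (_+ n) (vy-suc π m) ⟩
    Y m + δy m + n                ≡⟨ xy∙z≈xz∙y (Y m) (δy m) n ⟩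
    Y m + n + δy m                ≡⟨ cong (_+ δy m) (height+X m) ⟨
    height m + X m + δy m         ≡⟨ xy∙z≈xz∙y (height m) (X m) (δy m) ⟩
    height m + δy m + X m         ∎)
    where open ≡-Reasoning

  height-rise≤1 : ∀ {m} → δy m ≤ 1 → height (suc m) ≤ suc (height m)
  height-rise≤1 {m} δy≤1 = sum≡⇒≤ (sym (height-step m)) (≤-trans δy≤1 (s≤s z≤n))

  height-fall≤1 : ∀ {m} → δx m ≤ 1 → height m ≤ suc (height (suc m))
  height-fall≤1 {m} δx≤1 = sum≡⇒≤ (height-step m) (≤-trans δx≤1 (s≤s z≤n))

  height-nonincreasing : ∀ {m} → δy m ≤ δx m → height (suc m) ≤ height m
  height-nonincreasing {m} = sum≡⇒≤ (sym (height-step m))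

  height-rises-by : ∀ {m} d → d + δx m ≤ δy m → d + height m ≤ height (suc m)
  height-rises-by {m} d = sum≡⇒≥ (height-step m)

  Subdiagonalʰ Superdiagonalʰ SubExcursion SuperExcursion : ℕ → ℕ → Set
  Subdiagonalʰ   i j = ∀ q → i ≤ q → q ≤ j → height q ≤ height i
  Superdiagonalʰ i j = ∀ q → i ≤ q → q ≤ j → height i ≤ height q
  SubExcursion   i j = NonemptySubpath π i j × height i ≡ height j × Subdiagonalʰ i j
  SuperExcursion i j = NonemptySubpath π i j × height i ≡ height j × Superdiagonalʰ i j

  subdiagonal⇔ : ∀ i j → Subdiagonalʰ i j ⇔ Subdiagonal π i j
  subdiagonal⇔ i j = pointwise⇔ λ q →
    subst₂ (λ a b → height q ≤ height i ⇔ a ≤ b) (+-comm (X i) (Y q)) (+-comm (Y i) (X q))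
           (height-≤⇔ q i)

  superdiagonal⇔ : ∀ i j → Superdiagonalʰ i j ⇔ Superdiagonal π i j
  superdiagonal⇔ i j = pointwise⇔ (height-≤⇔ i)

  data ActiveVertex (v : ℕ) : Set where
    onDiagonal      : height v ≡ n → ActiveVertex v
    startsExcursion : height v < n → ∃ (SubExcursion v) → ActiveVertex v
    endsExcursion   : n < height v → ∃ (λ i → SuperExcursion i v) → ActiveVertex v

  ActiveLine : ℕ → Set
  ActiveLine k = ∃[ v ] (v ≤ N × X v ≡ k × ActiveVertex v)

  active⇔ : ∀ k → Active π k ⇔ ActiveLine k
  active⇔ k = mk⇔ toLine fromLine
    where
    toLine : Active π k → ActiveLine k
    toLine (v , v≤N , Xv≡k , inj₁ diagonal) =
      v , v≤N , Xv≡k , onDiagonal (from (height-≡⇔ v 0) diagonal)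
    toLine (v , v≤N , Xv≡k , inj₂ (inj₁ (below , j , nonempty , balanced , sub))) =
      v , v≤N , Xv≡k , startsExcursion (from (below⇔ v) below)
        (j , nonempty , from (height-≡⇔ v j) balanced , from (subdiagonal⇔ v j) sub)
    toLine (v , v≤N , Xv≡k , inj₂ (inj₂ (above , i , nonempty , balanced , super))) =
      v , v≤N , Xv≡k , endsExcursion (from (above⇔ v) above)
        (i , nonempty , from (height-≡⇔ i v) balanced , from (superdiagonal⇔ i v) super)

    fromLine : ActiveLine k → Active π k
    fromLine (v , v≤N , Xv≡k , onDiagonal hv≡n) =
      v , v≤N , Xv≡k , inj₁ (to (height-≡⇔ v 0) hv≡n)
    fromLine (v , v≤N , Xv≡k , startsExcursion hv<n (j , nonempty , balanced , sub)) =
      v , v≤N , Xv≡k , inj₂ (inj₁ (to (below⇔ v) hv<n ,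
        j , nonempty , to (height-≡⇔ v j) balanced , to (subdiagonal⇔ v j) sub))
    fromLine (v , v≤N , Xv≡k , endsExcursion n<hv (i , nonempty , balanced , super)) =
      v , v≤N , Xv≡k , inj₂ (inj₂ (to (above⇔ v) n<hv ,
        i , nonempty , to (height-≡⇔ i v) balanced , to (superdiagonal⇔ i v) super))

  below⇒subExcursion : ∀ {v} → height v < n → ActiveVertex v → ∃ (SubExcursion v)
  below⇒subExcursion hv<n (onDiagonal hv≡n)       = ⊥-elim (<-irrefl hv≡n hv<n)
  below⇒subExcursion _    (startsExcursion _ exc) = exc
  below⇒subExcursion hv<n (endsExcursion n<hv _)  = ⊥-elim (<-asym hv<n n<hv)

  above⇒superExcursion : ∀ {v} → n < height v → ActiveVertex v → ∃ (λ i → SuperExcursion i v)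
  above⇒superExcursion n<hv (onDiagonal hv≡n)        = ⊥-elim (<-irrefl (sym hv≡n) n<hv)
  above⇒superExcursion n<hv (startsExcursion hv<n _) = ⊥-elim (<-asym hv<n n<hv)
  above⇒superExcursion _    (endsExcursion _ exc)    = exc

  module FromDelannoy (delannoy : IsDelannoy π) where

    private
      bounded : ∀ {m} → m < N → δx m ≤ 1 × δy m ≤ 1
      bounded m<N = delannoy-bounded (All-stepAt delannoy m<N)

    X-rising : ∀ {a} → Rising X a N
    X-rising m _ m<N = begin
      X (suc m)  ≡⟨ vx-suc π m ⟩
      X m + δx m ≤⟨ +-monoʳ-≤ (X m) (proj₁ (bounded m<N)) ⟩
      X m + 1    ≡⟨ +-comm (X m) 1 ⟩
      suc (X m)  ∎
      where open ≤-Reasoning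

    height-rising : ∀ {m} → m < N → height (suc m) ≤ suc (height m)
    height-rising m<N = height-rise≤1 (proj₂ (bounded m<N))

    nonvertical⇒nonrising : ∀ {m} → m < N → X m < X (suc m) → height (suc m) ≤ height m
    nonvertical⇒nonrising m<N Xm<X[1+m] = height-nonincreasing
      (≤-trans (proj₂ (bounded m<N))
               (n≢0⇒n>0 λ δx≡0 → <-irrefl (sym (δx≡0⇒vertical δx≡0)) Xm<X[1+m]))

    subExcursion-from : ∀ {e} → e < N → height (suc e) ≤ height e → height e < n → ∃ (SubExcursion e)
    subExcursion-from {e} e<N h[1+e]≤he he<n
      with first-hit-rising height (≤⇒≤‴ e<N) h[1+e]≤he
             (subst (height e ≤_) (sym height-end) (<⇒≤ he<n)) (λ q _ → height-rising)
    ... | j , e<j , j≤N , hj≡he , below =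
      j , (e<j , j≤N) , sym hj≡he ,
      with-ends ≤-refl (≤-reflexive hj≡he) (λ q e<q q<j → <⇒≤ (below q e<q q<j))

    superExcursion-to : ∀ {v} → v < N → height (suc v) ≤ height v → n < height (suc v) →
                   ∃ (λ i → SuperExcursion i (suc v))
    superExcursion-to {v} v<N h[1+v]≤hv n<h[1+v]
      with last-hit-rising height (≤⇒≤′ z≤n) (<⇒≤ n<h[1+v]) h[1+v]≤hv
             (λ q _ q<v → height-rising (<-trans q<v v<N))
    ... | i , _ , i≤v , hi≡h[1+v] , above =
      i , (s≤s i≤v , v<N) , hi≡h[1+v] ,
      with-ends ≤-refl (≤-reflexive hi≡h[1+v])
        (λ q i<q q<1+v → <⇒≤ (subst (_< height q) (sym hi≡h[1+v]) (above q i<q (≤-pred q<1+v))))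

    line-ends : ∀ {k} → 1 ≤ k → k < n →
      ∃₂ λ s e → suc s ≤ e × e < N × X (suc s) ≡ k × X e ≡ k × X s < X (suc s) × X e < X (suc e)
    line-ends {k} 1≤k k<n
      with first-hit-rising X (≤⇒≤‴ z≤n) z≤n k≤X[N] X-rising
         | last-hit-rising X (≤⇒≤′ z≤n) z≤n k≤X[N] X-rising
      where
      k≤X[N] : k ≤ X N
      k≤X[N] = subst (k ≤_) (sym (X-end ≤-refl)) (<⇒≤ k<n)
    ... | zero , _ , _ , X0≡k , _ | _ = ⊥-elim (<-irrefl X0≡k 1≤k)
    ... | suc s , _ , 1+s≤N , X[1+s]≡k , before | e , _ , _ , Xe≡k , after =
      s , e , first≤last , e<N , X[1+s]≡k , Xe≡k ,
      subst (X s <_) (sym X[1+s]≡k) (before s z≤n ≤-refl) ,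
      subst (_< X (suc e)) (sym Xe≡k) (after (suc e) ≤-refl e<N)
      where
      e<N : e < N
      e<N = ≰⇒> λ N≤e → <-irrefl (trans (sym Xe≡k) (X-end N≤e)) k<n
      first≤last : suc s ≤ e
      first≤last = ≮⇒≥ λ e<1+s → <-irrefl (sym X[1+s]≡k) (after (suc s) e<1+s 1+s≤N)

    line-active : ∀ {k} → 1 ≤ k → k < n → ActiveLine k
    line-active 1≤k k<n with line-ends 1≤k k<n
    ... | s , e , 1+s≤e , e<N , X[1+s]≡k , Xe≡k , Xs<X[1+s] , Xe<X[1+e]
      with height e <? n | n <? height (suc s)
    ... | yes he<n | _ =
      e , <⇒≤ e<N , Xe≡k ,
      startsExcursion he<n (subExcursion-from e<N (nonvertical⇒nonrising e<N Xe<X[1+e]) he<n)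
    ... | no _ | yes n<h[1+s] =
      suc s , s<N , X[1+s]≡k ,
      endsExcursion n<h[1+s] (superExcursion-to s<N (nonvertical⇒nonrising s<N Xs<X[1+s]) n<h[1+s])
      where
      s<N : s < N
      s<N = ≤-trans 1+s≤e (<⇒≤ e<N)
    ... | no he≮n | no n≮h[1+s]
      with first-hit-rising height (≤⇒≤‴ 1+s≤e) (≮⇒≥ n≮h[1+s]) (≮⇒≥ he≮n)
             (λ q _ q<e → height-rising (<-trans q<e e<N))
    ... | m , 1+s≤m , m≤e , hm≡n , _ =
      m , ≤-trans m≤e (<⇒≤ e<N) ,
      ≤-antisym (subst (X m ≤_) Xe≡k (X-mono m≤e)) (subst (_≤ X m) X[1+s]≡k (X-mono 1+s≤m)) ,
      onDiagonal hm≡n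

  wide-gap : ∀ {t} → 1 < δx t → suc (X t) < X (suc t)
  wide-gap {t} 1<δx = begin
    2 + X t    ≡⟨ +-comm 2 (X t) ⟩
    X t + 2    ≤⟨ +-monoʳ-≤ (X t) 1<δx ⟩
    X t + δx t ≡⟨ vx-suc π t ⟨
    X (suc t)  ∎
    where open ≤-Reasoning

  ¬wide-step : ∀ {t} → 1 < δx t → ¬ ActiveLine (suc (X t))
  ¬wide-step {t} 1<δx (v , _ , Xv≡1+Xt , _) =
    ¬X-strictly-between t v (subst (X t <_) (sym Xv≡1+Xt) (n<1+n (X t)))
                            (subst (_< X (suc t)) (sym Xv≡1+Xt) (wide-gap 1<δx))

  module _ (gp : GeneralPath π) where

    vertical⇒height-rises : ∀ {m} → m < N → X (suc m) ≡ X m → height m < height (suc m)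
    vertical⇒height-rises {m} m<N vertical = height-rises-by 1
      (subst (λ z → 1 + z ≤ δy m) (sym δx≡0) (isStep-vertical (All-stepAt gp m<N) δx≡0))
      where
      δx≡0 : δx m ≡ 0
      δx≡0 = vertical⇒δx≡0 vertical

    nonrising⇒nonvertical : ∀ {m} → m < N → height (suc m) ≤ height m → X m < X (suc m)
    nonrising⇒nonvertical m<N h[1+m]≤hm = ≤∧≢⇒< (X-mono (n≤1+n _)) λ Xm≡X[1+m] →
      <⇒≱ (vertical⇒height-rises m<N (sym Xm≡X[1+m])) h[1+m]≤hm

    subExcursion⇒last-on-line : ∀ {v j w} → SubExcursion v j → X w ≡ X v → w ≤ v
    subExcursion⇒last-on-line {v} ((v<j , j≤N) , _ , sub) =
      before-line-end (nonrising⇒nonvertical (<-≤-trans v<j j≤N) (sub (suc v) (n≤1+n v) v<j))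

    superExcursion⇒first-on-line : ∀ {i v w} → SuperExcursion i v → X w ≡ X v → v ≤ w
    superExcursion⇒first-on-line {v = zero} ((() , _) , _)
    superExcursion⇒first-on-line {v = suc v} ((i<1+v , 1+v≤N) , hi≡h[1+v] , super) =
      after-line-start (nonrising⇒nonvertical 1+v≤N
        (subst (_≤ height v) hi≡h[1+v] (super v (≤-pred i<1+v) (n≤1+n v))))

    ¬jump-below : ∀ {m t} → m ≤ t → X m < X (suc m) → height m < n →
                  (∀ q → m < q → q ≤ t → height q < height m) → height m < height (suc t) →
                  ¬ ActiveLine (X m)
    ¬jump-below {m} {t} m≤t Xm<X[1+m] hm<n dips hm<h[1+t] (v , _ , Xv≡Xm , witness) =
      noReturn (below⇒subExcursion (≤-<-trans hv≤hm hm<n) witness)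
      where
      v≤m : v ≤ m
      v≤m = before-line-end Xm<X[1+m] Xv≡Xm
      hv≤hm : height v ≤ height m
      hv≤hm = height-along-line v≤m Xv≡Xm
      noReturn : ∃ (SubExcursion v) → ⊥
      noReturn (j , exc@((v<j , _) , hv≡hj , sub)) with j ≤? t
      ... | yes j≤t = <-irrefl (sym hv≡hj)
        (<-≤-trans (dips j (≤-<-trans m≤v v<j) j≤t) (height-along-line m≤v (sym Xv≡Xm)))
        where
        m≤v : m ≤ v
        m≤v = subExcursion⇒last-on-line exc (sym Xv≡Xm)
      ... | no j≰t = <⇒≱ hm<h[1+t]
        (≤-trans (sub (suc t) (≤-trans v≤m (≤-trans m≤t (n≤1+n t))) (≰⇒> j≰t)) hv≤hm)

    ¬jump-above : ∀ {t m} → t ≤ m → X m < X (suc m) → n < height (suc m) →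
                  (∀ q → t < q → q ≤ m → height (suc m) < height q) → height t < height (suc m) →
                  ¬ ActiveLine (X (suc m))
    ¬jump-above {t} {m} t≤m Xm<X[1+m] n<h[1+m] peaks ht<h[1+m] (v , _ , Xv≡X[1+m] , witness) =
      noDeparture (above⇒superExcursion (<-≤-trans n<h[1+m] h[1+m]≤hv) witness)
      where
      1+m≤v : suc m ≤ v
      1+m≤v = after-line-start Xm<X[1+m] Xv≡X[1+m]
      h[1+m]≤hv : height (suc m) ≤ height v
      h[1+m]≤hv = height-along-line 1+m≤v (sym Xv≡X[1+m])
      noDeparture : ∃ (λ i → SuperExcursion i v) → ⊥
      noDeparture (i , exc@((i<v , _) , hi≡hv , super)) with t <? i
      ... | yes t<i = <⇒≱ (peaks i t<i (≤-pred (<-≤-trans i<v v≤1+m)))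
        (≤-trans (≤-reflexive hi≡hv) (height-along-line v≤1+m Xv≡X[1+m]))
        where
        v≤1+m : v ≤ suc m
        v≤1+m = superExcursion⇒first-on-line exc (sym Xv≡X[1+m])
      ... | no t≮i = <⇒≱ ht<h[1+m]
        (≤-trans h[1+m]≤hv (≤-trans (≤-reflexive (sym hi≡hv))
          (super t (≮⇒≥ t≮i) (≤-trans t≤m (≤-trans (n≤1+n m) 1+m≤v)))))

    ¬vertical-crossing : ∀ {t} → X (suc t) ≡ X t → height t < n → n < height (suc t) →
                         ¬ ActiveLine (X t)
    ¬vertical-crossing {t} vertical ht<n n<h[1+t] (v , _ , Xv≡Xt , witness) with v ≤? t
    ... | yes v≤t = ≤⇒≯ v≤t (subExcursion⇒last-on-line
      (proj₂ (below⇒subExcursion (≤-<-trans (height-along-line v≤t Xv≡Xt) ht<n) witness))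
      (trans vertical (sym Xv≡Xt)))
    ... | no v≰t = ≤⇒≯ (superExcursion⇒first-on-line
      (proj₂ (above⇒superExcursion (<-≤-trans n<h[1+t] (height-along-line t<v (trans vertical (sym Xv≡Xt))))
                           witness))
      (sym Xv≡Xt)) t<v
      where
      t<v : t < v
      t<v = ≰⇒> v≰t

    module FromActive (active : ∀ {k} → 1 ≤ k → k < n → ActiveLine k) where

      δx≤1 : ∀ t → δx t ≤ 1
      δx≤1 t = ≮⇒≥ λ 1<δx →
        ¬wide-step 1<δx (active (s≤s z≤n) (<-≤-trans (wide-gap 1<δx) (X≤n (suc t))))

      height-falling : ∀ {a b} → Falling height a b
      height-falling q _ _ = height-fall≤1 (δx≤1 q)

      ¬tall-slanted : ∀ {t} → X t < X (suc t) → height t < height (suc t) → ⊥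
      ¬tall-slanted {t} Xt<X[1+t] ht<h[1+t] with height t <? n
      ... | yes ht<n =
        ¬jump-below ≤-refl Xt<X[1+t] ht<n (λ q t<q q≤t → ⊥-elim (<⇒≱ t<q q≤t)) ht<h[1+t]
          (active (below⇒1≤X t ht<n) (<-≤-trans Xt<X[1+t] (X≤n (suc t))))
      ... | no ht≮n =
        ¬jump-above ≤-refl Xt<X[1+t] n<h[1+t] (λ q t<q q≤t → ⊥-elim (<⇒≱ t<q q≤t)) ht<h[1+t]
          (active (≤-<-trans z≤n Xt<X[1+t]) (above⇒X<n (suc t) n<h[1+t]))
        where
        n<h[1+t] : n < height (suc t)
        n<h[1+t] = ≤-<-trans (≮⇒≥ ht≮n) ht<h[1+t]

      ¬steep-above : ∀ {t} → t < N → n ≤ height t → 2 + height t ≤ height (suc t) → ⊥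
      ¬steep-above {t} t<N n≤ht climb
        with first-hit-falling height (≤⇒≤‴ t<N) (≤-trans (n≤1+n _) climb)
               (subst (_≤ suc (height t)) (sym height-end) (≤-trans n≤ht (n≤1+n _))) height-falling
      ... | m , 1+t≤m , m≤N , hm≡1+ht , above with m≤n⇒m<n∨m≡n 1+t≤m
      ...   | inj₂ refl = <-irrefl (sym hm≡1+ht) climb
      ...   | inj₁ (s≤s {n = m} t<m) =
        ¬jump-above (<⇒≤ t<m) Xm<X[1+m] n<h[1+m] peaks (subst (height t <_) (sym hm≡1+ht) (n<1+n _))
          (active (≤-<-trans z≤n Xm<X[1+m]) (above⇒X<n (suc m) n<h[1+m]))
        where
        Xm<X[1+m] : X m < X (suc m)
        Xm<X[1+m] = nonrising⇒nonvertical m≤N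
          (<⇒≤ (subst (_< height m) (sym hm≡1+ht) (above m t<m ≤-refl)))
        n<h[1+m] : n < height (suc m)
        n<h[1+m] = subst (n <_) (sym hm≡1+ht) (s≤s n≤ht)
        peaks : ∀ q → t < q → q ≤ m → height (suc m) < height q
        peaks q t<q q≤m = subst (_< height q) (sym hm≡1+ht) (above q t<q (s≤s q≤m))

      ¬steep-below : ∀ {t} → t < N → suc (height t) < n → 2 + height t ≤ height (suc t) → ⊥
      ¬steep-below {t} t<N 1+ht<n climb
        with last-hit-falling height (≤⇒≤′ z≤n) (<⇒≤ 1+ht<n) (n≤1+n _) height-falling
      ... | m , _ , m≤t , hm≡1+ht , below with m≤n⇒m<n∨m≡n m≤t
      ...   | inj₂ refl = <-irrefl hm≡1+ht (n<1+n _)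
      ...   | inj₁ m<t =
        ¬jump-below (<⇒≤ m<t) Xm<X[1+m] hm<n dips (subst (_< height (suc t)) (sym hm≡1+ht) climb)
          (active (below⇒1≤X m hm<n) (<-≤-trans Xm<X[1+m] (X≤n (suc m))))
        where
        Xm<X[1+m] : X m < X (suc m)
        Xm<X[1+m] = nonrising⇒nonvertical (<-trans m<t t<N)
          (<⇒≤ (subst (height (suc m) <_) (sym hm≡1+ht) (below (suc m) ≤-refl m<t)))
        hm<n : height m < n
        hm<n = subst (_< n) (sym hm≡1+ht) 1+ht<n
        dips : ∀ q → m < q → q ≤ t → height q < height m
        dips q m<q q≤t = subst (height q <_) (sym hm≡1+ht) (below q m<q q≤t)

      ¬tall-vertical : ∀ {t} → t < N → X (suc t) ≡ X t → 2 + height t ≤ height (suc t) → ⊥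
      ¬tall-vertical {t} t<N vertical climb with n ≤? height t | suc (height t) <? n
      ... | yes n≤ht | _          = ¬steep-above t<N n≤ht climb
      ... | no _     | yes 1+ht<n = ¬steep-below t<N 1+ht<n climb
      ... | no n≰ht  | no 1+ht≮n  =
        ¬vertical-crossing vertical ht<n n<h[1+t]
          (active (below⇒1≤X t ht<n) (subst (_< n) vertical (above⇒X<n (suc t) n<h[1+t])))
        where
        ht<n : height t < n
        ht<n = ≰⇒> n≰ht
        n<h[1+t] : n < height (suc t)
        n<h[1+t] = <-≤-trans (s≤s (≮⇒≥ 1+ht≮n)) climb

      ¬tall-step : ∀ {t} → t < N → 1 < δy t → ⊥
      ¬tall-step {t} t<N 1<δy with m≤n⇒m<n∨m≡n (X-mono (n≤1+n t))
      ... | inj₁ Xt<X[1+t] =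
        ¬tall-slanted Xt<X[1+t] (height-rises-by 1 (≤-trans (s≤s (δx≤1 t)) 1<δy))
      ... | inj₂ Xt≡X[1+t] = ¬tall-vertical t<N (sym Xt≡X[1+t])
        (height-rises-by 2 (subst (λ z → 2 + z ≤ δy t) (sym (vertical⇒δx≡0 (sym Xt≡X[1+t]))) 1<δy))

      delannoy : IsDelannoy π
      delannoy = stepAt-All π λ {t} t<N →
        bounded-delannoy (All-stepAt gp t<N) (δx≤1 t) (≮⇒≥ (¬tall-step t<N))

proposition1 : (n : ℕ) → 1 ≤ n → (π : List Step) → GeneralPath π →
    endpoint π ≡ (n , n) →
    (IsDelannoy π ⇔ (∀ k → 1 ≤ k → k ≤ n ∸ 1 → Active π k))
proposition1 (suc n) _ π gp end = mk⇔
  (λ isDelannoy k 1≤k k≤n → from (active⇔ k) (FromDelannoy.line-active isDelannoy 1≤k (s≤s k≤n)))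
  (λ active → FromActive.delannoy gp λ {k} 1≤k k≤n → to (active⇔ k) (active k 1≤k (≤-pred k≤n)))
  where open Heights π (suc n) end
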